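{- Let $p$ be a distribution on $[n]$ with $d_{\mathrm{TV}}(p,\mathcal{U}_n)=\varepsilon>0$ and let $z=(p-\mathcal{U}_n)/\varepsilon$. For any $i\in[n]$ and any integer $j\ge 0$, if $S\subseteq[n]$ is a random set including each element independently with probability $2^{ -j}$, then $\Pr\left[z(S\setminus\{i\})\ge \frac{4}{2^j}\right]\le 1/4$.
   Context: $\mathcal{U}_n$ is the uniform distribution on $[n]$; $z(A)=\sum_{k\in A}z(k)$; $d_{\mathrm{TV}}(p,q)=\frac12\sum_i|p(i)-q(i)|$.
   Formalization: The distribution $p$ takes values in the rationals, so $\varepsilon$ and $z$ are rational as well. -}

module Defs where

open import Data.Nat using (ℕ; zero; suc; NonZero)
open import Data.Integer using (+_)
open import Data.Rational using (ℚ; 0ℚ; 1ℚ; _+_; _*_; _-_; _÷_; _/_; ∣_∣; _≤_; _<_)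
open import Data.Rational using (>-nonZero)
open import Data.Fin using (Fin; zero; suc)
open import Data.Fin.Subset using (Subset; Side; inside; outside; _─_; ⁅_⁆)
open import Data.Vec using (Vec; []; _∷_; lookup)
open import Data.List using (List; []; _∷_; map; _++_)
open import Data.Product using (_×_)
open import Relation.Binary.PropositionalEquality using (_≡_)
open import Relation.Nullary using (Dec; yes; no)

sumFin : ∀ {n} → (Fin n → ℚ) → ℚ
sumFin {zero}  f = 0ℚ
sumFin {suc n} f = f zero + sumFin (λ k → f (suc k))

½ : ℚ
½ = + 1 / 2

2^-_ : ℕ → ℚ
2^- zero  = 1ℚ
2^- suc j = ½ * (2^- j)

IsDistribution : ∀ {n} → (Fin n → ℚ) → Set
IsDistribution p = (∀ k → 0ℚ ≤ p k) × (sumFin p ≡ 1ℚ)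

uniform : (n : ℕ) → .{{_ : NonZero n}} → Fin n → ℚ
uniform n _ = + 1 / n

dTV : ∀ {n} → (Fin n → ℚ) → (Fin n → ℚ) → ℚ
dTV p q = ½ * sumFin (λ k → ∣ p k - q k ∣)

zVec : (n : ℕ) → .{{_ : NonZero n}} → (p : Fin n → ℚ) → (ε : ℚ) → 0ℚ < ε → Fin n → ℚ
zVec n p ε εpos k = _÷_ (p k - uniform n k) ε {{>-nonZero εpos}}

zSet : ∀ {n} → (Fin n → ℚ) → Subset n → ℚ
zSet z A = sumFin (λ k → indicator (lookup A k) (z k))
  where
  indicator : Side → ℚ → ℚ
  indicator inside  x = x
  indicator outside _ = 0ℚ

allSubsets : (n : ℕ) → List (Subset n)
allSubsets zero    = [] ∷ []
allSubsets (suc n) = map (inside ∷_) (allSubsets n) ++ map (outside ∷_) (allSubsets n)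

-- probability that the random set (each element independently with prob. q) equals S
subsetWeight : ∀ {n} → ℚ → Subset n → ℚ
subsetWeight q []            = 1ℚ
subsetWeight q (inside ∷ S)  = q * subsetWeight q S
subsetWeight q (outside ∷ S) = (1ℚ - q) * subsetWeight q S

sumList : List ℚ → ℚ
sumList []       = 0ℚ
sumList (x ∷ xs) = x + sumList xs

Pr : (n : ℕ) → ℚ → (P : Subset n → Set) → ((S : Subset n) → Dec (P S)) → ℚ
Pr n q P P? = sumList (map term (allSubsets n))
  where
  term : Subset n → ℚ
  term S with P? S
  ... | yes _ = subsetWeight q S
  ... | no  _ = 0ℚ

-- Write z⁺ for the positive part of z. Since Σ z = 0 and ½ Σ |z| = d_TV(p, U_n)/ε = 1,
-- Σ z⁺ = ½ (Σ |z| + Σ z) = 1. Dropping i and the negative entries can only increase the sum,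
-- so z(S ∖ {i}) ≤ z⁺(S), while by linearity of expectation 𝔼[z⁺(S)] = 2⁻ʲ Σ z⁺ = 2⁻ʲ.
-- Markov's inequality at 4·2⁻ʲ gives the bound.

{-# OPTIONS --safe #-}
module Submission where

open import Defs
open import Data.Nat using (ℕ; NonZero)
open import Data.Integer using (+_)
open import Data.Rational using (ℚ; 0ℚ; _*_; _/_; _≤_; _<_; _≤?_)
open import Data.Fin using (Fin)
open import Data.Fin.Subset using (_─_; ⁅_⁆)
open import Relation.Binary.PropositionalEquality using (_≡_)

open import Algebra.Bundles using (CommutativeRing)
open import Data.Fin using (zero; suc)
open import Data.Fin.Subset using (Subset; inside; outside; _⊆_)
open import Data.Fin.Subset.Properties using (drop-∷-⊆; p─q⊆p)
import Data.Integer as ℤ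
import Data.Integer.Properties as ℤ
open import Data.List using (List; []; _∷_; map; _++_)
open import Data.List.Properties using (map-∘; map-cong)
import Data.Nat as ℕ
import Data.Rational as ℚ
open import Data.Product using (Σ; _,_; proj₁; proj₂)
open import Data.Rational
  using (1ℚ; _+_; _-_; -_; ∣_∣; _⊔_; 1/_; toℚᵘ; Positive; positive; NonNegative; nonNegative; >-nonZero)
open import Data.Rational.Properties
open import Data.Rational.Solver using (module +-*-Solver)
open import Data.Rational.Unnormalised as ℚᵘ using (mkℚᵘ; *≡*)
import Data.Rational.Unnormalised.Properties as ℚᵘ
open import Data.Sum using (inj₁; inj₂)
open import Data.Vec using ([]; _∷_; here)
open import Function using (_∘_)
open import Relation.Binary.PropositionalEquality
  using (refl; sym; trans; cong; cong₂; subst; module ≡-Reasoning)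
open import Relation.Nullary using (Dec; yes; no)
open import Relation.Unary using (Decidable)

open import Algebra.Properties.Semiring.Sum (CommutativeRing.semiring +-*-commutativeRing)
  using (sum; sum-cong-≗; ∑-distrib-+; *-distribˡ-sum; *-distribʳ-sum)

open +-*-Solver using (solve; _:+_; _:-_; :-_; _:*_; _:=_; con)

sumFin≡sum : ∀ {n} (f : Fin n → ℚ) → sumFin f ≡ sum f
sumFin≡sum {ℕ.zero}  f = refl
sumFin≡sum {ℕ.suc n} f = cong (λ s → f zero + s) (sumFin≡sum (f ∘ suc))

sumList-map-++ : ∀ {A : Set} (f : A → ℚ) (xs ys : List A) →
                 sumList (map f (xs ++ ys)) ≡ sumList (map f xs) + sumList (map f ys)
sumList-map-++ f []       ys = sym (+-identityˡ _)
sumList-map-++ f (x ∷ xs) ys =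
  trans (cong (λ s → f x + s) (sumList-map-++ f xs ys)) (sym (+-assoc (f x) _ _))

sumList-map-*ˡ : ∀ {A : Set} (c : ℚ) (f : A → ℚ) (xs : List A) →
                 sumList (map (λ x → c * f x) xs) ≡ c * sumList (map f xs)
sumList-map-*ˡ c f []       = sym (*-zeroʳ c)
sumList-map-*ˡ c f (x ∷ xs) =
  trans (cong (λ s → c * f x + s) (sumList-map-*ˡ c f xs)) (sym (*-distribˡ-+ c (f x) _))

sumList-map-mono : ∀ {A : Set} {f g : A → ℚ} → (∀ x → f x ≤ g x) → (xs : List A) →
                   sumList (map f xs) ≤ sumList (map g xs)
sumList-map-mono f≤g []       = ≤-refl
sumList-map-mono f≤g (x ∷ xs) = +-mono-≤ (f≤g x) (sumList-map-mono f≤g xs)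

subsetWeight-nonNeg : ∀ {q} → 0ℚ ≤ q → q ≤ 1ℚ → ∀ {n} (S : Subset n) → NonNegative (subsetWeight q S)
subsetWeight-nonNeg 0≤q q≤1 [] = _
subsetWeight-nonNeg {q} 0≤q q≤1 (inside ∷ S) =
  nonNeg*nonNeg⇒nonNeg q {{nonNegative 0≤q}} _ {{subsetWeight-nonNeg 0≤q q≤1 S}}
subsetWeight-nonNeg {q} 0≤q q≤1 (outside ∷ S) =
  nonNeg*nonNeg⇒nonNeg (1ℚ - q) {{nonNegative 0≤1-q}} _ {{subsetWeight-nonNeg 0≤q q≤1 S}}
  where
  0≤1-q : 0ℚ ≤ 1ℚ - q
  0≤1-q = subst (_≤ 1ℚ - q) (+-inverseʳ q) (+-monoˡ-≤ (- q) q≤1)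

𝔼 : (n : ℕ) → ℚ → (Subset n → ℚ) → ℚ
𝔼 n q X = sumList (map (λ S → subsetWeight q S * X S) (allSubsets n))

𝔼-suc : ∀ n q (X : Subset (ℕ.suc n) → ℚ) →
        𝔼 (ℕ.suc n) q X ≡ q * 𝔼 n q (X ∘ (inside ∷_)) + (1ℚ - q) * 𝔼 n q (X ∘ (outside ∷_))
𝔼-suc n q X = begin
  sumList (map term (map (inside ∷_) Ss ++ map (outside ∷_) Ss))
    ≡⟨ sumList-map-++ term (map (inside ∷_) Ss) (map (outside ∷_) Ss) ⟩
  sumList (map term (map (inside ∷_) Ss)) + sumList (map term (map (outside ∷_) Ss))
    ≡⟨ cong₂ _+_ (cong sumList (sym (map-∘ Ss))) (cong sumList (sym (map-∘ Ss))) ⟩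
  sumList (map (term ∘ (inside ∷_)) Ss) + sumList (map (term ∘ (outside ∷_)) Ss)
    ≡⟨ cong₂ _+_ (pull q (X ∘ (inside ∷_))) (pull (1ℚ - q) (X ∘ (outside ∷_))) ⟩
  q * 𝔼 n q (X ∘ (inside ∷_)) + (1ℚ - q) * 𝔼 n q (X ∘ (outside ∷_)) ∎
  where
  open ≡-Reasoning
  Ss : List (Subset n)
  Ss = allSubsets n
  term : Subset (ℕ.suc n) → ℚ
  term S = subsetWeight q S * X S
  pull : ∀ c (Y : Subset n → ℚ) →
         sumList (map (λ S → (c * subsetWeight q S) * Y S) Ss) ≡ c * 𝔼 n q Y
  pull c Y = trans (cong sumList (map-cong (λ S → *-assoc c (subsetWeight q S) (Y S)) Ss))
                   (sumList-map-*ˡ c (λ S → subsetWeight q S * Y S) Ss)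

𝔼-+-const : ∀ n q c (X : Subset n → ℚ) → 𝔼 n q (λ S → c + X S) ≡ c + 𝔼 n q X
𝔼-+-const ℕ.zero q c X =
  solve 2 (λ c x → con 1ℚ :* (c :+ x) :+ con 0ℚ := c :+ (con 1ℚ :* x :+ con 0ℚ)) refl c (X [])
𝔼-+-const (ℕ.suc n) q c X = begin
  𝔼 (ℕ.suc n) q (λ S → c + X S)
    ≡⟨ 𝔼-suc n q (λ S → c + X S) ⟩
  q * 𝔼 n q (λ S → c + X (inside ∷ S)) + (1ℚ - q) * 𝔼 n q (λ S → c + X (outside ∷ S))
    ≡⟨ cong₂ (λ a b → q * a + (1ℚ - q) * b) (𝔼-+-const n q c _) (𝔼-+-const n q c _) ⟩
  q * (c + Eᵢ) + (1ℚ - q) * (c + Eₒ)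
    ≡⟨ solve 4 (λ q c a b → q :* (c :+ a) :+ (con 1ℚ :- q) :* (c :+ b)
                          := c :+ (q :* a :+ (con 1ℚ :- q) :* b)) refl q c Eᵢ Eₒ ⟩
  c + (q * Eᵢ + (1ℚ - q) * Eₒ)
    ≡⟨ cong (λ e → c + e) (𝔼-suc n q X) ⟨
  c + 𝔼 (ℕ.suc n) q X ∎
  where
  open ≡-Reasoning
  Eᵢ Eₒ : ℚ
  Eᵢ = 𝔼 n q (X ∘ (inside ∷_))
  Eₒ = 𝔼 n q (X ∘ (outside ∷_))

𝔼-zSet : ∀ n q (g : Fin n → ℚ) → 𝔼 n q (zSet g) ≡ q * sumFin g
𝔼-zSet ℕ.zero q g = solve 1 (λ q → con 1ℚ :* con 0ℚ :+ con 0ℚ := q :* con 0ℚ) refl q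
𝔼-zSet (ℕ.suc n) q g = begin
  𝔼 (ℕ.suc n) q (zSet g)
    ≡⟨ 𝔼-suc n q (zSet g) ⟩
  q * 𝔼 n q (λ S → g zero + zSet g′ S) + (1ℚ - q) * 𝔼 n q (λ S → 0ℚ + zSet g′ S)
    ≡⟨ cong₂ (λ a b → q * a + (1ℚ - q) * b)
             (𝔼-+-const n q (g zero) (zSet g′)) (𝔼-+-const n q 0ℚ (zSet g′)) ⟩
  q * (g zero + 𝔼 n q (zSet g′)) + (1ℚ - q) * (0ℚ + 𝔼 n q (zSet g′))
    ≡⟨ cong (λ e → q * (g zero + e) + (1ℚ - q) * (0ℚ + e)) (𝔼-zSet n q g′) ⟩
  q * (g zero + q * sumFin g′) + (1ℚ - q) * (0ℚ + q * sumFin g′)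
    ≡⟨ solve 3 (λ q a s → q :* (a :+ q :* s) :+ (con 1ℚ :- q) :* (con 0ℚ :+ q :* s)
                        := q :* (a :+ s)) refl q (g zero) (sumFin g′) ⟩
  q * sumFin g ∎
  where
  open ≡-Reasoning
  g′ : Fin n → ℚ
  g′ = g ∘ suc

𝔼-*ˡ : ∀ n q c (X : Subset n → ℚ) → 𝔼 n q (λ S → c * X S) ≡ c * 𝔼 n q X
𝔼-*ˡ n q c X = trans (cong sumList (map-cong swap (allSubsets n)))
                     (sumList-map-*ˡ c (λ S → subsetWeight q S * X S) (allSubsets n))
  where
  swap : ∀ S → subsetWeight q S * (c * X S) ≡ c * (subsetWeight q S * X S)
  swap S = solve 3 (λ w c x → w :* (c :* x) := c :* (w :* x)) refl (subsetWeight q S) c (X S)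

𝔼-mono : ∀ {n q} {X Y : Subset n → ℚ} → 0ℚ ≤ q → q ≤ 1ℚ → (∀ S → X S ≤ Y S) → 𝔼 n q X ≤ 𝔼 n q Y
𝔼-mono {n} {q} {X} {Y} 0≤q q≤1 X≤Y = sumList-map-mono weighted (allSubsets n)
  where
  weighted : ∀ S → subsetWeight q S * X S ≤ subsetWeight q S * Y S
  weighted S = *-monoˡ-≤-nonNeg (subsetWeight q S) {{subsetWeight-nonNeg 0≤q q≤1 S}} (X≤Y S)

𝟙 : {A : Set} → Dec A → ℚ
𝟙 (yes _) = 1ℚ
𝟙 (no _)  = 0ℚ

Pr≡𝔼𝟙 : ∀ n q (P : Subset n → Set) (P? : Decidable P) → Pr n q P P? ≡ 𝔼 n q (𝟙 ∘ P?)
Pr≡𝔼𝟙 n q P P? = trans (proj₂ summand) (cong sumList (map-cong summand≡ (allSubsets n)))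
  where
  -- Pr's summand is a where-bound function of Defs that cannot be named directly;
  -- capturing it here lets `with` compute it.
  summand : Σ (Subset n → ℚ) λ T → Pr n q P P? ≡ sumList (map T (allSubsets n))
  summand = _ , refl
  summand≡ : ∀ S → proj₁ summand S ≡ subsetWeight q S * 𝟙 (P? S)
  summand≡ S with P? S
  ... | yes _ = sym (*-identityʳ (subsetWeight q S))
  ... | no _  = sym (*-zeroʳ (subsetWeight q S))

markov : ∀ {n q t} {P : Subset n → Set} (P? : Decidable P) (X : Subset n → ℚ) →
         0ℚ ≤ q → q ≤ 1ℚ → (∀ S → 0ℚ ≤ X S) → (∀ S → P S → t ≤ X S) →
         t * Pr n q P P? ≤ 𝔼 n q X
markov {n} {q} {t} {P} P? X 0≤q q≤1 0≤X t≤X = begin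
  t * Pr n q P P?            ≡⟨ cong (t *_) (Pr≡𝔼𝟙 n q P P?) ⟩
  t * 𝔼 n q (𝟙 ∘ P?)         ≡⟨ 𝔼-*ˡ n q t (𝟙 ∘ P?) ⟨
  𝔼 n q (λ S → t * 𝟙 (P? S)) ≤⟨ 𝔼-mono 0≤q q≤1 t𝟙≤X ⟩
  𝔼 n q X                    ∎
  where
  open ≤-Reasoning
  t𝟙≤X : ∀ S → t * 𝟙 (P? S) ≤ X S
  t𝟙≤X S with P? S
  ... | yes PS = ≤-trans (≤-reflexive (*-identityʳ t)) (t≤X S PS)
  ... | no _   = ≤-trans (≤-reflexive (*-zeroʳ t)) (0≤X S)

zSet-monoˡ : ∀ {n} {f g : Fin n → ℚ} → (∀ k → f k ≤ g k) → ∀ A → zSet f A ≤ zSet g A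
zSet-monoˡ f≤g []            = ≤-refl
zSet-monoˡ f≤g (inside ∷ A)  = +-mono-≤ (f≤g zero) (zSet-monoˡ (f≤g ∘ suc) A)
zSet-monoˡ f≤g (outside ∷ A) = +-monoʳ-≤ 0ℚ (zSet-monoˡ (f≤g ∘ suc) A)

zSet-nonNeg : ∀ {n} {g : Fin n → ℚ} → (∀ k → 0ℚ ≤ g k) → ∀ A → 0ℚ ≤ zSet g A
zSet-nonNeg 0≤g []            = ≤-refl
zSet-nonNeg 0≤g (inside ∷ A)  = +-mono-≤ (0≤g zero) (zSet-nonNeg (0≤g ∘ suc) A)
zSet-nonNeg 0≤g (outside ∷ A) = +-mono-≤ ≤-refl (zSet-nonNeg (0≤g ∘ suc) A)

zSet-mono-⊆ : ∀ {n} {g : Fin n → ℚ} → (∀ k → 0ℚ ≤ g k) → ∀ {A B} → A ⊆ B → zSet g A ≤ zSet g B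
zSet-mono-⊆ 0≤g {[]} {[]} _ = ≤-refl
zSet-mono-⊆ {g = g} 0≤g {inside ∷ A} {inside ∷ B} A⊆B =
  +-monoʳ-≤ (g zero) (zSet-mono-⊆ (0≤g ∘ suc) (drop-∷-⊆ A⊆B))
zSet-mono-⊆ 0≤g {inside ∷ A} {outside ∷ B} A⊆B with () ← A⊆B here
zSet-mono-⊆ 0≤g {outside ∷ A} {inside ∷ B} A⊆B =
  +-mono-≤ (0≤g zero) (zSet-mono-⊆ (0≤g ∘ suc) (drop-∷-⊆ A⊆B))
zSet-mono-⊆ 0≤g {outside ∷ A} {outside ∷ B} A⊆B =
  +-monoʳ-≤ 0ℚ (zSet-mono-⊆ (0≤g ∘ suc) (drop-∷-⊆ A⊆B))

_⁺ : ℚ → ℚ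
x ⁺ = x ⊔ 0ℚ

x⁺≡½[∣x∣+x] : ∀ x → x ⁺ ≡ ½ * (∣ x ∣ + x)
x⁺≡½[∣x∣+x] x with ≤-total 0ℚ x
... | inj₁ 0≤x = begin
  x ⊔ 0ℚ          ≡⟨ p≥q⇒p⊔q≡p 0≤x ⟩
  x               ≡⟨ solve 1 (λ x → x := con ½ :* (x :+ x)) refl x ⟩
  ½ * (x + x)     ≡⟨ cong (λ a → ½ * (a + x)) (0≤p⇒∣p∣≡p 0≤x) ⟨
  ½ * (∣ x ∣ + x) ∎
  where open ≡-Reasoning
... | inj₂ x≤0 = begin
  x ⊔ 0ℚ          ≡⟨ p≤q⇒p⊔q≡q x≤0 ⟩
  0ℚ              ≡⟨ solve 1 (λ x → con 0ℚ := con ½ :* (:- x :+ x)) refl x ⟩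
  ½ * (- x + x)   ≡⟨ cong (λ a → ½ * (a + x)) ∣x∣≡-x ⟨
  ½ * (∣ x ∣ + x) ∎
  where
  open ≡-Reasoning
  ∣x∣≡-x : ∣ x ∣ ≡ - x
  ∣x∣≡-x = trans (sym (∣-p∣≡∣p∣ x)) (0≤p⇒∣p∣≡p (neg-antimono-≤ x≤0))

sumFin-⁺ : ∀ {n} (z : Fin n → ℚ) → sumFin (λ k → z k ⁺) ≡ ½ * (sumFin (λ k → ∣ z k ∣) + sumFin z)
sumFin-⁺ z = begin
  sumFin (λ k → z k ⁺)                    ≡⟨ sumFin≡sum (λ k → z k ⁺) ⟩
  sum (λ k → z k ⁺)                       ≡⟨ sum-cong-≗ (λ k → x⁺≡½[∣x∣+x] (z k)) ⟩
  sum (λ k → ½ * (∣ z k ∣ + z k))         ≡⟨ *-distribˡ-sum ½ (λ k → ∣ z k ∣ + z k) ⟨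
  ½ * sum (λ k → ∣ z k ∣ + z k)           ≡⟨ cong (½ *_) (∑-distrib-+ (λ k → ∣ z k ∣) z) ⟩
  ½ * (sum (λ k → ∣ z k ∣) + sum z)
    ≡⟨ cong (½ *_) (cong₂ _+_ (sumFin≡sum (λ k → ∣ z k ∣)) (sumFin≡sum z)) ⟨
  ½ * (sumFin (λ k → ∣ z k ∣) + sumFin z) ∎
  where open ≡-Reasoning

+a/d++b/d≡+[a+b]/d : ∀ a b d .{{_ : NonZero d}} → + a / d + + b / d ≡ + (a ℕ.+ b) / d
+a/d++b/d≡+[a+b]/d a b (ℕ.suc m) = toℚᵘ-injective (begin
  toℚᵘ (+ a / d + + b / d)                ≈⟨ toℚᵘ-homo-+ (+ a / d) (+ b / d) ⟩
  toℚᵘ (+ a / d) ℚᵘ.+ toℚᵘ (+ b / d)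
    ≈⟨ ℚᵘ.+-cong (toℚᵘ-fromℚᵘ (mkℚᵘ (+ a) m)) (toℚᵘ-fromℚᵘ (mkℚᵘ (+ b) m)) ⟩
  mkℚᵘ (+ a) m ℚᵘ.+ mkℚᵘ (+ b) m         ≈⟨ *≡* cross ⟩
  mkℚᵘ (+ (a ℕ.+ b)) m                    ≈⟨ toℚᵘ-fromℚᵘ (mkℚᵘ (+ (a ℕ.+ b)) m) ⟨
  toℚᵘ (+ (a ℕ.+ b) / d)                  ∎)
  where
  open ℚᵘ.≃-Reasoning
  d = ℕ.suc m
  cross : (+ a ℤ.* + d ℤ.+ + b ℤ.* + d) ℤ.* + d ≡ + (a ℕ.+ b) ℤ.* (+ d ℤ.* + d)
  cross = trans (cong (ℤ._* + d) (sym (ℤ.*-distribʳ-+ (+ d) (+ a) (+ b))))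
                (ℤ.*-assoc (+ (a ℕ.+ b)) (+ d) (+ d))

sumFin-uniform : ∀ n .{{_ : NonZero n}} → sumFin (uniform n) ≡ 1ℚ
sumFin-uniform n@(ℕ.suc m) =
  trans (sumFin-1/n n) (fromℚᵘ-cong {mkℚᵘ (+ n) m} {ℚᵘ.1ℚᵘ} (*≡* (ℤ.*-comm (+ n) (+ 1))))
  where
  sumFin-1/n : ∀ k → sumFin {k} (λ _ → + 1 / n) ≡ + k / n
  sumFin-1/n ℕ.zero    = sym (0/n≡0 n)
  sumFin-1/n (ℕ.suc k) = trans (cong (λ s → + 1 / n + s) (sumFin-1/n k)) (+a/d++b/d≡+[a+b]/d 1 k n)

module _ (n : ℕ) .{{_ : NonZero n}} (p : Fin n → ℚ) (ε : ℚ) (εpos : 0ℚ < ε) where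

  private
    instance
      ε≢0 : ℚ.NonZero ε
      ε≢0 = >-nonZero εpos

    z : Fin n → ℚ
    z = zVec n p ε εpos

    0≤1/ε : 0ℚ ≤ 1/ ε
    0≤1/ε = <⇒≤ (positive⁻¹ _ {{1/pos⇒pos ε {{positive εpos}}}})

  sumFin-zVec : sumFin p ≡ 1ℚ → sumFin z ≡ 0ℚ
  sumFin-zVec Σp≡1 = begin
    sumFin z
      ≡⟨ sumFin≡sum z ⟩
    sum z
      ≡⟨ sum-cong-≗ split ⟩
    sum (λ k → e * p k + (- e) * u k)
      ≡⟨ ∑-distrib-+ (λ k → e * p k) (λ k → (- e) * u k) ⟩
    sum (λ k → e * p k) + sum (λ k → (- e) * u k)
      ≡⟨ cong₂ _+_ (*-distribˡ-sum e p) (*-distribˡ-sum (- e) u) ⟨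
    e * sum p + (- e) * sum u
      ≡⟨ cong₂ (λ a b → e * a + (- e) * b) (sum≡1 p Σp≡1) (sum≡1 u (sumFin-uniform n)) ⟩
    e * 1ℚ + (- e) * 1ℚ
      ≡⟨ solve 1 (λ e → e :* con 1ℚ :+ (:- e) :* con 1ℚ := con 0ℚ) refl e ⟩
    0ℚ ∎
    where
    open ≡-Reasoning
    e : ℚ
    e = 1/ ε
    u : Fin n → ℚ
    u = uniform n
    split : ∀ k → z k ≡ e * p k + (- e) * u k
    split k = solve 3 (λ x y e → (x :- y) :* e := e :* x :+ (:- e) :* y) refl (p k) (u k) e
    sum≡1 : (f : Fin n → ℚ) → sumFin f ≡ 1ℚ → sum f ≡ 1ℚ
    sum≡1 f Σf≡1 = trans (sym (sumFin≡sum f)) Σf≡1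

  ½-sumFin-∣zVec∣ : dTV p (uniform n) ≡ ε → ½ * sumFin (λ k → ∣ z k ∣) ≡ 1ℚ
  ½-sumFin-∣zVec∣ dTV≡ε = begin
    ½ * sumFin (λ k → ∣ z k ∣)       ≡⟨ cong (½ *_) (sumFin≡sum (λ k → ∣ z k ∣)) ⟩
    ½ * sum (λ k → ∣ z k ∣)          ≡⟨ cong (½ *_) (sum-cong-≗ ∣d*e∣≡∣d∣*e) ⟩
    ½ * sum (λ k → ∣ d k ∣ * e)      ≡⟨ cong (½ *_) (*-distribʳ-sum e (λ k → ∣ d k ∣)) ⟨
    ½ * (sum (λ k → ∣ d k ∣) * e)    ≡⟨ cong (λ s → ½ * (s * e)) (sumFin≡sum (λ k → ∣ d k ∣)) ⟨
    ½ * (sumFin (λ k → ∣ d k ∣) * e) ≡⟨ *-assoc ½ (sumFin (λ k → ∣ d k ∣)) e ⟨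
    dTV p (uniform n) * e            ≡⟨ cong (_* e) dTV≡ε ⟩
    ε * e                            ≡⟨ *-inverseʳ ε ⟩
    1ℚ                               ∎
    where
    open ≡-Reasoning
    e : ℚ
    e = 1/ ε
    d : Fin n → ℚ
    d k = p k - uniform n k
    ∣d*e∣≡∣d∣*e : ∀ k → ∣ d k * e ∣ ≡ ∣ d k ∣ * e
    ∣d*e∣≡∣d∣*e k = trans (∣p*q∣≡∣p∣*∣q∣ (d k) e) (cong (∣ d k ∣ *_) (0≤p⇒∣p∣≡p 0≤1/ε))

  sumFin-zVec⁺ : sumFin p ≡ 1ℚ → dTV p (uniform n) ≡ ε → sumFin (λ k → z k ⁺) ≡ 1ℚ
  sumFin-zVec⁺ Σp≡1 dTV≡ε = begin
    sumFin (λ k → z k ⁺)                    ≡⟨ sumFin-⁺ z ⟩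
    ½ * (sumFin (λ k → ∣ z k ∣) + sumFin z)
      ≡⟨ cong (λ s → ½ * (sumFin (λ k → ∣ z k ∣) + s)) (sumFin-zVec Σp≡1) ⟩
    ½ * (sumFin (λ k → ∣ z k ∣) + 0ℚ)       ≡⟨ cong (½ *_) (+-identityʳ (sumFin (λ k → ∣ z k ∣))) ⟩
    ½ * sumFin (λ k → ∣ z k ∣)              ≡⟨ ½-sumFin-∣zVec∣ dTV≡ε ⟩
    1ℚ                                      ∎
    where open ≡-Reasoning

2^-j-pos : ∀ j → Positive (2^- j)
2^-j-pos ℕ.zero    = _
2^-j-pos (ℕ.suc j) = pos*pos⇒pos ½ (2^- j) {{2^-j-pos j}}

2^-j≤1 : ∀ j → 2^- j ≤ 1ℚ
2^-j≤1 ℕ.zero    = ≤-refl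
2^-j≤1 (ℕ.suc j) = ≤-trans (*-monoˡ-≤-nonNeg ½ (2^-j≤1 j)) (≤ᵇ⇒≤ _)

lemma4p5 : (n : ℕ) → .{{_ : NonZero n}} → (p : Fin n → ℚ) → IsDistribution p →
    (ε : ℚ) → (εpos : 0ℚ < ε) → dTV p (uniform n) ≡ ε →
    (i : Fin n) → (j : ℕ) →
    Pr n (2^- j)
       (λ S → (+ 4 / 1) * (2^- j) ≤ zSet (zVec n p ε εpos) (S ─ ⁅ i ⁆))
       (λ S → (+ 4 / 1) * (2^- j) ≤? zSet (zVec n p ε εpos) (S ─ ⁅ i ⁆))
      ≤ + 1 / 4
lemma4p5 n p (_ , Σp≡1) ε εpos dTV≡ε i j = *-cancelˡ-≤-pos t (begin
  t * Pr n q P P?    ≤⟨ markov P? (zSet z⁺) 0≤q (2^-j≤1 j) (zSet-nonNeg 0≤z⁺) t≤z⁺[S] ⟩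
  𝔼 n q (zSet z⁺)    ≡⟨ 𝔼-zSet n q z⁺ ⟩
  q * sumFin z⁺      ≡⟨ cong (q *_) (sumFin-zVec⁺ n p ε εpos Σp≡1 dTV≡ε) ⟩
  q * 1ℚ             ≡⟨ solve 1 (λ q → q :* con 1ℚ := (con (+ 4 / 1) :* q) :* con (+ 1 / 4)) refl q ⟩
  t * (+ 1 / 4)      ∎)
  where
  open ≤-Reasoning
  q t : ℚ
  q = 2^- j
  t = (+ 4 / 1) * q
  instance
    q>0 : Positive q
    q>0 = 2^-j-pos j
    t>0 : Positive t
    t>0 = pos*pos⇒pos (+ 4 / 1) q
  0≤q : 0ℚ ≤ q
  0≤q = <⇒≤ (positive⁻¹ q)
  z z⁺ : Fin n → ℚ
  z = zVec n p ε εpos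
  z⁺ k = z k ⁺
  0≤z⁺ : ∀ k → 0ℚ ≤ z⁺ k
  0≤z⁺ k = p≤q⊔p (z k) 0ℚ
  P : Subset n → Set
  P S = t ≤ zSet z (S ─ ⁅ i ⁆)
  P? : Decidable P
  P? S = t ≤? zSet z (S ─ ⁅ i ⁆)
  t≤z⁺[S] : ∀ S → P S → t ≤ zSet z⁺ S
  t≤z⁺[S] S t≤z[S-i] = begin
    t                     ≤⟨ t≤z[S-i] ⟩
    zSet z (S ─ ⁅ i ⁆)    ≤⟨ zSet-monoˡ (λ k → p≤p⊔q (z k) 0ℚ) (S ─ ⁅ i ⁆) ⟩
    zSet z⁺ (S ─ ⁅ i ⁆)   ≤⟨ zSet-mono-⊆ 0≤z⁺ (p─q⊆p S ⁅ i ⁆) ⟩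
    zSet z⁺ S             ∎
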